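{- For every $n \in \{0,1,2,\ldots\}$, \begin{align*} \sum_{j=0}^{n} \sum_{i=0}^j \frac{\binom{n+1}{i}}{\binom{2n+1}{j}} & = \sum_{k=0}^{\lfloor n/2 \rfloor} (-1)^k \,\frac{\binom{n+1}{2k+1}}{\binom{n}{k}} \\ & = (n+1)\sum_{k=1}^{n+1}\frac{2^k}{k \,\binom{n+1+k}{k}} \\ & = \frac{n+1}{2^{n+1}} \sum_{k=1}^{n+1} \frac{2^k}{k} \\ & = \frac{1}{2^n} \sum_{j=0}^{n} \sum_{i=0}^j \frac{\binom{n+1}{i}}{\binom{n}{j}}. \end{align*} -}

module Defs where

open import Data.Nat as ℕ using (ℕ; zero; suc)
open import Data.Integer using (+_)
open import Data.Rational using (ℚ; 0ℚ; _+_; _*_; _/_; 1ℚ)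

sumTo : ℕ → (ℕ → ℚ) → ℚ
sumTo zero    f = f 0
sumTo (suc n) f = sumTo n f + f (suc n)

sum1To : ℕ → (ℕ → ℚ) → ℚ
sum1To zero    f = 0ℚ
sum1To (suc n) f = sum1To n f + f (suc n)

ℕtoℚ : ℕ → ℚ
ℕtoℚ n = (+ n) / 1

-- division by a natural number; by convention x ÷ℕ 0 = 0
-- (every denominator in proposition13 is a nonzero natural, so this convention is never used there)
_÷ℕ_ : ℚ → ℕ → ℚ
x ÷ℕ zero  = 0ℚ
x ÷ℕ suc d = x * ((+ 1) / suc d)

infixl 7 _÷ℕ_

sign : ℕ → ℚ
sign zero    = 1ℚ
sign (suc k) = Data.Rational.- sign k

module Submission where

-- Each of the five expressions of proposition13 is evaluated to the same
-- value  (n+1) · (Σ_{k≤n} 2^k/(k+1)) / 2^n.  The tool is the family of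
-- rational "beta numbers"  β a b = a! b! / (a+b+1)!  (the integral of
-- x^a (1-x)^b over [0,1]): reciprocal binomial coefficients are multiples of
-- β, and β obeys the splitting law  β a b = β (a+1) b + β a (b+1).

module BetaSums where

  open import Defs
  open import Data.Nat as ℕ using (ℕ; zero; suc; _!; _^_)
  import Data.Nat.Properties as ℕP
  open import Data.Nat.Combinatorics using (_C_; nCk≡n!/k![n-k]!; k>n⇒nCk≡0; k![n∸k]!∣n!; nCk+nC[k+1]≡[n+1]C[k+1])
  open import Data.Nat.DivMod using (_/_; _%_; m/n*n≡m; m≡m%n+[m/n]*n; m%n<n; m/n≤m)
  import Data.Nat.Tactic.RingSolver as ℕSolver
  import Data.Integer as ℤ
  import Data.Integer.Properties as ℤP
  open import Data.Rational using (ℚ; _+_; _*_; -_; _-_; 0ℚ; 1ℚ; toℚᵘ; fromℚᵘ)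
  open import Data.Rational.Properties
  import Data.Rational.Unnormalised as ℚᵘ
  import Data.Rational.Unnormalised.Properties as ℚᵘP
  open import Data.Rational.Solver using (module +-*-Solver)
  open +-*-Solver
  open import Data.Empty using (⊥-elim)
  open import Data.Sum using (inj₂)
  open import Data.Product using (_,_)
  open import Data.List using (_∷_; [])
  open import Relation.Nullary using (yes; no)
  open import Relation.Binary.PropositionalEquality

  ι : ℕ → ℚ
  ι = ℕtoℚ

  -- The successor case is checked in the unnormalised rationals, where ι n
  -- is literally the fraction n/1.
  ι-suc : ∀ n → ι (suc n) ≡ 1ℚ + ι n
  ι-suc n = toℚᵘ-injective (begin
      toℚᵘ (ι (suc n))
        ≈⟨ toℚᵘ-fromℚᵘ (ℚᵘ.mkℚᵘ (ℤ.+ suc n) 0) ⟩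
      ℚᵘ.mkℚᵘ (ℤ.+ suc n) 0
        ≈⟨ ℚᵘ.*≡* (trans (ℤP.*-identityʳ _) (sym (trans (ℤP.*-identityʳ _) (cong (ℤ._+_ (ℤ.+ 1)) (ℤP.*-identityʳ (ℤ.+ n)))))) ⟩
      ℚᵘ.mkℚᵘ (ℤ.+ 1) 0 ℚᵘ.+ ℚᵘ.mkℚᵘ (ℤ.+ n) 0
        ≈⟨ ℚᵘP.+-cong (toℚᵘ-fromℚᵘ (ℚᵘ.mkℚᵘ (ℤ.+ 1) 0)) (toℚᵘ-fromℚᵘ (ℚᵘ.mkℚᵘ (ℤ.+ n) 0)) ⟨
      toℚᵘ 1ℚ ℚᵘ.+ toℚᵘ (ι n)
        ≈⟨ toℚᵘ-homo-+ 1ℚ (ι n) ⟨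
      toℚᵘ (1ℚ + ι n) ∎)
    where open ℚᵘP.≃-Reasoning

  ι-+ : ∀ a b → ι (a ℕ.+ b) ≡ ι a + ι b
  ι-+ zero    b = sym (+-identityˡ (ι b))
  ι-+ (suc a) b = begin
    ι (suc (a ℕ.+ b))   ≡⟨ ι-suc (a ℕ.+ b) ⟩
    1ℚ + ι (a ℕ.+ b)    ≡⟨ cong (1ℚ +_) (ι-+ a b) ⟩
    1ℚ + (ι a + ι b)    ≡⟨ +-assoc 1ℚ (ι a) (ι b) ⟨
    (1ℚ + ι a) + ι b    ≡⟨ cong (_+ ι b) (ι-suc a) ⟨
    ι (suc a) + ι b     ∎
    where open ≡-Reasoning

  ι-* : ∀ a b → ι (a ℕ.* b) ≡ ι a * ι b
  ι-* zero    b = sym (*-zeroˡ (ι b))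
  ι-* (suc a) b = begin
    ι (b ℕ.+ a ℕ.* b)   ≡⟨ ι-+ b (a ℕ.* b) ⟩
    ι b + ι (a ℕ.* b)   ≡⟨ cong (ι b +_) (ι-* a b) ⟩
    ι b + ι a * ι b     ≡⟨ solve 2 (λ x y → y :+ x :* y := (con 1ℚ :+ x) :* y) refl (ι a) (ι b) ⟩
    (1ℚ + ι a) * ι b    ≡⟨ cong (_* ι b) (ι-suc a) ⟨
    ι (suc a) * ι b     ∎
    where open ≡-Reasoning

  -- The reciprocal of a natural number (with the convention 1/0 = 0 of _÷ℕ_).
  recip : ℕ → ℚ
  recip d = 1ℚ ÷ℕ d

  ÷ℕ-recip : ∀ x d → x ÷ℕ d ≡ x * recip d
  ÷ℕ-recip x zero    = sym (*-zeroʳ x)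
  ÷ℕ-recip x (suc d) = cong (x *_) (sym (*-identityˡ _))

  ι*recip : ∀ d → d ≢ 0 → ι d * recip d ≡ 1ℚ
  ι*recip zero    d≢0 = ⊥-elim (d≢0 refl)
  ι*recip (suc d) _   = toℚᵘ-injective (begin
      toℚᵘ (ι (suc d) * recip (suc d))   ≈⟨ toℚᵘ-homo-* (ι (suc d)) (recip (suc d)) ⟩
      toℚᵘ (ι (suc d)) ℚᵘ.* toℚᵘ (1ℚ * fromℚᵘ 1/[1+d])
        ≈⟨ ℚᵘP.*-cong (toℚᵘ-fromℚᵘ (ℚᵘ.mkℚᵘ (ℤ.+ suc d) 0)) (ℚᵘP.≃-trans (toℚᵘ-homo-* 1ℚ (fromℚᵘ 1/[1+d])) (ℚᵘP.*-cong (toℚᵘ-fromℚᵘ (ℚᵘ.mkℚᵘ (ℤ.+ 1) 0)) (toℚᵘ-fromℚᵘ 1/[1+d]))) ⟩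
      ℚᵘ.mkℚᵘ (ℤ.+ suc d) 0 ℚᵘ.* (ℚᵘ.mkℚᵘ (ℤ.+ 1) 0 ℚᵘ.* 1/[1+d])
        ≈⟨ ℚᵘ.*≡* (cong (λ m → ℤ.+ suc m) (ℕSolver.solve (d ∷ []))) ⟩
      toℚᵘ 1ℚ ∎)
    where
    open ℚᵘP.≃-Reasoning
    1/[1+d] = ℚᵘ.mkℚᵘ (ℤ.+ 1) d

  isolate : ∀ {d x y} → d ≢ 0 → ι d * x ≡ y → x ≡ y * recip d
  isolate {d} {x} {y} d≢0 e = begin
    x                      ≡⟨ solve 1 (λ a → a := a :* con 1ℚ) refl x ⟩
    x * 1ℚ                 ≡⟨ cong (x *_) (ι*recip d d≢0) ⟨
    x * (ι d * recip d)    ≡⟨ solve 3 (λ a b c → a :* (b :* c) := (b :* a) :* c) refl x (ι d) (recip d) ⟩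
    ι d * x * recip d      ≡⟨ cong (_* recip d) e ⟩
    y * recip d            ∎
    where open ≡-Reasoning

  recip-* : ∀ a b → recip (a ℕ.* b) ≡ recip a * recip b
  recip-* zero    b = sym (*-zeroˡ (recip b))
  recip-* (suc a) zero rewrite ℕP.*-zeroʳ a = sym (*-zeroʳ (recip (suc a)))
  recip-* (suc a) (suc b) = sym (trans (isolate {suc a ℕ.* suc b} (λ ()) inverse) (*-identityˡ _))
    where
    open ≡-Reasoning
    inverse : ι (suc a ℕ.* suc b) * (recip (suc a) * recip (suc b)) ≡ 1ℚ
    inverse = begin
      ι (suc a ℕ.* suc b) * (recip (suc a) * recip (suc b))
        ≡⟨ cong (_* (recip (suc a) * recip (suc b))) (ι-* (suc a) (suc b)) ⟩
      ι (suc a) * ι (suc b) * (recip (suc a) * recip (suc b))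
        ≡⟨ solve 4 (λ w x y z → w :* x :* (y :* z) := (w :* y) :* (x :* z)) refl (ι (suc a)) (ι (suc b)) (recip (suc a)) (recip (suc b)) ⟩
      (ι (suc a) * recip (suc a)) * (ι (suc b) * recip (suc b))
        ≡⟨ cong₂ _*_ (ι*recip (suc a) (λ ())) (ι*recip (suc b) (λ ())) ⟩
      1ℚ ∎

  fraction-≡ : ∀ a c {d e} → d ≢ 0 → e ≢ 0 → a ℕ.* e ≡ c ℕ.* d → ι a * recip d ≡ ι c * recip e
  fraction-≡ a c {d} {e} d≢0 e≢0 ae≡cd = begin
    ι a * recip d                          ≡⟨ solve 2 (λ x y → x :* y := x :* y :* con 1ℚ) refl (ι a) (recip d) ⟩
    ι a * recip d * 1ℚ                     ≡⟨ cong (ι a * recip d *_) (ι*recip e e≢0) ⟨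
    ι a * recip d * (ι e * recip e)        ≡⟨ solve 4 (λ x y z w → x :* y :* (z :* w) := (x :* z) :* y :* w) refl (ι a) (recip d) (ι e) (recip e) ⟩
    (ι a * ι e) * recip d * recip e        ≡⟨ cong (λ z → z * recip d * recip e) (trans (sym (ι-* a e)) (trans (cong ι ae≡cd) (ι-* c d))) ⟩
    (ι c * ι d) * recip d * recip e        ≡⟨ solve 4 (λ x y z w → (x :* y) :* z :* w := x :* w :* (y :* z)) refl (ι c) (ι d) (recip d) (recip e) ⟩
    ι c * recip e * (ι d * recip d)        ≡⟨ cong (ι c * recip e *_) (ι*recip d d≢0) ⟩
    ι c * recip e * 1ℚ                     ≡⟨ *-identityʳ _ ⟩
    ι c * recip e                          ∎
    where open ≡-Reasoning

  +-to-- : ∀ {x y z} → x + y ≡ z → x ≡ z - y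
  +-to-- {x} {y} {z} e = trans (solve 2 (λ a b → a := a :+ b :- b) refl x y) (cong (_- y) e)

  sumTo-ext : ∀ n {f g : ℕ → ℚ} → (∀ i → f i ≡ g i) → sumTo n f ≡ sumTo n g
  sumTo-ext zero    f≗g = f≗g 0
  sumTo-ext (suc n) f≗g = cong₂ _+_ (sumTo-ext n f≗g) (f≗g (suc n))

  sumTo-*ˡ : ∀ n c (f : ℕ → ℚ) → sumTo n (λ i → c * f i) ≡ c * sumTo n f
  sumTo-*ˡ zero    c f = refl
  sumTo-*ˡ (suc n) c f = trans (cong (_+ c * f (suc n)) (sumTo-*ˡ n c f)) (sym (*-distribˡ-+ c (sumTo n f) (f (suc n))))

  sumTo-*ʳ : ∀ n c (f : ℕ → ℚ) → sumTo n (λ i → f i * c) ≡ sumTo n f * c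
  sumTo-*ʳ zero    c f = refl
  sumTo-*ʳ (suc n) c f = trans (cong (_+ f (suc n) * c) (sumTo-*ʳ n c f)) (sym (*-distribʳ-+ c (sumTo n f) (f (suc n))))

  sum1To-suc : ∀ n (f : ℕ → ℚ) → sum1To (suc n) f ≡ sumTo n (λ k → f (suc k))
  sum1To-suc zero    f = +-identityˡ (f 1)
  sum1To-suc (suc n) f = cong (_+ f (suc (suc n))) (sum1To-suc n f)

  sumTo-vanishing-tail : ∀ m p (f : ℕ → ℚ) → (∀ i → m ℕ.< i → f i ≡ 0ℚ) → sumTo (p ℕ.+ m) f ≡ sumTo m f
  sumTo-vanishing-tail m zero    f tail≡0 = refl
  sumTo-vanishing-tail m (suc p) f tail≡0 = begin
    sumTo (p ℕ.+ m) f + f (suc (p ℕ.+ m))  ≡⟨ cong₂ _+_ (sumTo-vanishing-tail m p f tail≡0) (tail≡0 (suc (p ℕ.+ m)) (ℕ.s≤s (ℕP.m≤n+m m p))) ⟩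
    sumTo m f + 0ℚ                          ≡⟨ +-identityʳ (sumTo m f) ⟩
    sumTo m f                               ∎
    where open ≡-Reasoning

  powSum : ℕ → (ℕ → ℚ) → ℚ
  powSum n g = sumTo n (λ k → ι (2 ^ k) * g k)

  antidiag : ℕ → (ℕ → ℕ → ℚ) → ℚ
  antidiag zero    f = f 0 0
  antidiag (suc n) f = f 0 (suc n) + antidiag n (λ l r → f (suc l) r)

  antidiag-ext : ∀ n {f g : ℕ → ℕ → ℚ} → (∀ l r → l ℕ.+ r ≡ n → f l r ≡ g l r) → antidiag n f ≡ antidiag n g
  antidiag-ext zero    f≗g = f≗g 0 0 refl
  antidiag-ext (suc n) f≗g = cong₂ _+_ (f≗g 0 (suc n) refl) (antidiag-ext n (λ l r l+r≡n → f≗g (suc l) r (cong suc l+r≡n)))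

  antidiag-+ : ∀ n (f g : ℕ → ℕ → ℚ) → antidiag n (λ l r → f l r + g l r) ≡ antidiag n f + antidiag n g
  antidiag-+ zero    f g = refl
  antidiag-+ (suc n) f g = begin
    f 0 (suc n) + g 0 (suc n) + antidiag n (λ l r → f (suc l) r + g (suc l) r)
      ≡⟨ cong (f 0 (suc n) + g 0 (suc n) +_) (antidiag-+ n (λ l r → f (suc l) r) (λ l r → g (suc l) r)) ⟩
    f 0 (suc n) + g 0 (suc n) + (F + G)
      ≡⟨ solve 4 (λ a b c d → a :+ b :+ (c :+ d) := a :+ c :+ (b :+ d)) refl (f 0 (suc n)) (g 0 (suc n)) F G ⟩
    f 0 (suc n) + F + (g 0 (suc n) + G) ∎
    where
    open ≡-Reasoning
    F = antidiag n (λ l r → f (suc l) r)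
    G = antidiag n (λ l r → g (suc l) r)

  antidiag-*ˡ : ∀ n c (f : ℕ → ℕ → ℚ) → antidiag n (λ l r → c * f l r) ≡ c * antidiag n f
  antidiag-*ˡ zero    c f = refl
  antidiag-*ˡ (suc n) c f = trans (cong (c * f 0 (suc n) +_) (antidiag-*ˡ n c (λ l r → f (suc l) r))) (sym (*-distribˡ-+ c (f 0 (suc n)) _))

  antidiag-neg : ∀ n (f : ℕ → ℕ → ℚ) → antidiag n (λ l r → - f l r) ≡ - antidiag n f
  antidiag-neg zero    f = refl
  antidiag-neg (suc n) f = trans (cong (- f 0 (suc n) +_) (antidiag-neg n (λ l r → f (suc l) r))) (sym (neg-distrib-+ (f 0 (suc n)) _))

  antidiag-last : ∀ n (f : ℕ → ℕ → ℚ) → antidiag (suc n) f ≡ antidiag n (λ l r → f l (suc r)) + f (suc n) 0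
  antidiag-last zero    f = refl
  antidiag-last (suc n) f = begin
    f 0 (suc (suc n)) + antidiag (suc n) (λ l r → f (suc l) r)
      ≡⟨ cong (f 0 (suc (suc n)) +_) (antidiag-last n (λ l r → f (suc l) r)) ⟩
    f 0 (suc (suc n)) + (antidiag n (λ l r → f (suc l) (suc r)) + f (suc (suc n)) 0)
      ≡⟨ +-assoc (f 0 (suc (suc n))) _ (f (suc (suc n)) 0) ⟨
    f 0 (suc (suc n)) + antidiag n (λ l r → f (suc l) (suc r)) + f (suc (suc n)) 0 ∎
    where open ≡-Reasoning

  sumTo-as-antidiag : ∀ n (f : ℕ → ℚ) → sumTo n f ≡ antidiag n (λ l r → f l)
  sumTo-as-antidiag zero    f = refl
  sumTo-as-antidiag (suc n) f = trans (peel-first n f) (cong (f 0 +_) (sumTo-as-antidiag n (λ i → f (suc i))))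
    where
    peel-first : ∀ n (f : ℕ → ℚ) → sumTo (suc n) f ≡ f 0 + sumTo n (λ i → f (suc i))
    peel-first zero    f = refl
    peel-first (suc n) f = trans (cong (_+ f (suc (suc n))) (peel-first n f)) (+-assoc (f 0) _ (f (suc (suc n))))

  prev : (ℕ → ℚ) → ℕ → ℚ
  prev f zero    = 0ℚ
  prev f (suc l) = f l

  antidiag-prev : ∀ n (c g : ℕ → ℕ → ℚ) →
                  antidiag (suc n) (λ l r → prev (λ j → c j r) l * g l r) ≡ antidiag n (λ l r → c l r * g (suc l) r)
  antidiag-prev n c g = trans (cong (_+ antidiag n (λ l r → c l r * g (suc l) r)) (*-zeroˡ (g 0 (suc n)))) (+-identityˡ _)

  !≢0 : ∀ n → n ! ≢ 0
  !≢0 n = ℕ.≢-nonZero⁻¹ (n !) {{n ℕP.!≢0}}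

  binomial-factorial : ∀ l s → ((l ℕ.+ s) C l) ℕ.* (l ! ℕ.* s !) ≡ (l ℕ.+ s) !
  binomial-factorial l s = begin
    ((l ℕ.+ s) C l) ℕ.* (l ! ℕ.* s !)               ≡⟨ cong (λ t → ((l ℕ.+ s) C l) ℕ.* (l ! ℕ.* t !)) (ℕP.m+n∸m≡n l s) ⟨
    ((l ℕ.+ s) C l) ℕ.* (l ! ℕ.* (l ℕ.+ s ℕ.∸ l) !)  ≡⟨ cong (ℕ._* (l ! ℕ.* (l ℕ.+ s ℕ.∸ l) !)) (nCk≡n!/k![n-k]! (ℕP.m≤m+n l s)) ⟩
    _                                                ≡⟨ m/n*n≡m {{l ℕP.!* (l ℕ.+ s ℕ.∸ l) !≢0}} (k![n∸k]!∣n! (ℕP.m≤m+n l s)) ⟩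
    (l ℕ.+ s) !                                      ∎
    where open ≡-Reasoning

  binomial≢0 : ∀ l s → ((l ℕ.+ s) C l) ≢ 0
  binomial≢0 l s C≡0 = !≢0 (l ℕ.+ s) (trans (sym (binomial-factorial l s)) (cong (ℕ._* (l ! ℕ.* s !)) C≡0))

  β : ℕ → ℕ → ℚ
  β a b = ι (a ! ℕ.* b !) * recip (suc (a ℕ.+ b) !)

  PascalLike : (ℕ → ℕ → ℚ) → Set
  PascalLike γ = ∀ l r → γ l r ≡ γ (suc l) r + γ l (suc r)

  -- β a b = β (a+1) b + β a (b+1), from (a+b+2) = (a+1) + (b+1).
  β-pascal : PascalLike β
  β-pascal a b = begin
    β a b
      ≡⟨ fraction-≡ (a ! ℕ.* b !) (suc a ! ℕ.* b ! ℕ.+ a ! ℕ.* suc b !) (!≢0 (suc (a ℕ.+ b))) (!≢0 (suc (suc (a ℕ.+ b)))) (factorials a b (a !) (b !) (suc (a ℕ.+ b) !)) ⟩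
    ι (suc a ! ℕ.* b ! ℕ.+ a ! ℕ.* suc b !) * recip (suc (suc (a ℕ.+ b)) !)
      ≡⟨ trans (cong (_* recip (suc (suc (a ℕ.+ b)) !)) (ι-+ (suc a ! ℕ.* b !) (a ! ℕ.* suc b !))) (*-distribʳ-+ (recip (suc (suc (a ℕ.+ b)) !)) (ι (suc a ! ℕ.* b !)) (ι (a ! ℕ.* suc b !))) ⟩
    β (suc a) b + ι (a ! ℕ.* suc b !) * recip (suc (suc (a ℕ.+ b)) !)
      ≡⟨ cong (λ t → β (suc a) b + ι (a ! ℕ.* suc b !) * recip (suc t !)) (ℕP.+-suc a b) ⟨
    β (suc a) b + β a (suc b) ∎
    where
    open ≡-Reasoning
    factorials : ∀ a b x y z → x ℕ.* y ℕ.* (suc (suc (a ℕ.+ b)) ℕ.* z) ≡ (suc a ℕ.* x ℕ.* y ℕ.+ x ℕ.* (suc b ℕ.* y)) ℕ.* z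
    factorials = ℕSolver.solve-∀

  β-sym : ∀ a b → β a b ≡ β b a
  β-sym a b = cong₂ (λ u v → ι u * recip (suc v !)) (ℕP.*-comm (a !) (b !)) (ℕP.+-comm a b)

  β-zeroʳ : ∀ k → β k 0 ≡ recip (suc k)
  β-zeroʳ k = begin
    β k 0                             ≡⟨ cong (λ t → ι (k ! ℕ.* 1) * recip (suc t !)) (ℕP.+-identityʳ k) ⟩
    ι (k ! ℕ.* 1) * recip (suc k !)   ≡⟨ fraction-≡ (k ! ℕ.* 1) 1 (!≢0 (suc k)) (λ ()) (factorials k (k !)) ⟩
    1ℚ * recip (suc k)                ≡⟨ *-identityˡ (recip (suc k)) ⟩
    recip (suc k)                     ∎
    where
    open ≡-Reasoning
    factorials : ∀ k x → x ℕ.* 1 ℕ.* suc k ≡ 1 ℕ.* (suc k ℕ.* x)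
    factorials = ℕSolver.solve-∀

  β-diagonal : ∀ m → ι 2 * β (suc m) m ≡ β m m
  β-diagonal m = begin
    ι 2 * (ι (suc m ! ℕ.* m !) * recip D)   ≡⟨ *-assoc (ι 2) (ι (suc m ! ℕ.* m !)) (recip D) ⟨
    ι 2 * ι (suc m ! ℕ.* m !) * recip D     ≡⟨ cong (_* recip D) (ι-* 2 (suc m ! ℕ.* m !)) ⟨
    ι (2 ℕ.* (suc m ! ℕ.* m !)) * recip D   ≡⟨ fraction-≡ (2 ℕ.* (suc m ! ℕ.* m !)) (m ! ℕ.* m !) (!≢0 (suc (suc (m ℕ.+ m)))) (!≢0 (suc (m ℕ.+ m))) (factorials m (m !) (suc (m ℕ.+ m) !)) ⟩
    β m m                                   ∎
    where
    open ≡-Reasoning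
    D = suc (suc (m ℕ.+ m)) !
    factorials : ∀ m x z → 2 ℕ.* (suc m ℕ.* x ℕ.* x) ℕ.* z ≡ x ℕ.* x ℕ.* (suc (suc (m ℕ.+ m)) ℕ.* z)
    factorials = ℕSolver.solve-∀

  ι-scale : ∀ x y d → ι x * (ι y * recip d) ≡ ι (x ℕ.* y) * recip d
  ι-scale x y d = trans (sym (*-assoc (ι x) (ι y) (recip d))) (cong (_* recip d) (sym (ι-* x y)))

  recip-binomial : ∀ l s → recip ((l ℕ.+ s) C l) ≡ ι (suc (l ℕ.+ s)) * β l s
  recip-binomial l s = begin
    recip B                                              ≡⟨ *-identityˡ (recip B) ⟨
    ι 1 * recip B                                        ≡⟨ fraction-≡ 1 (suc (l ℕ.+ s) ℕ.* (l ! ℕ.* s !)) (binomial≢0 l s) (!≢0 (suc (l ℕ.+ s))) cross ⟩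
    ι (suc (l ℕ.+ s) ℕ.* (l ! ℕ.* s !)) * recip (suc (l ℕ.+ s) !)  ≡⟨ ι-scale (suc (l ℕ.+ s)) (l ! ℕ.* s !) (suc (l ℕ.+ s) !) ⟨
    ι (suc (l ℕ.+ s)) * β l s                            ∎
    where
    open ≡-Reasoning
    B = (l ℕ.+ s) C l
    rearrange : ∀ t c x → 1 ℕ.* (suc t ℕ.* (c ℕ.* x)) ≡ suc t ℕ.* x ℕ.* c
    rearrange = ℕSolver.solve-∀
    cross : 1 ℕ.* suc (l ℕ.+ s) ! ≡ suc (l ℕ.+ s) ℕ.* (l ! ℕ.* s !) ℕ.* B
    cross = trans (cong (λ z → 1 ℕ.* (suc (l ℕ.+ s) ℕ.* z)) (sym (binomial-factorial l s))) (rearrange (l ℕ.+ s) B (l ! ℕ.* s !))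

  recip-suc*binomial : ∀ k m → recip (suc k ℕ.* ((suc k ℕ.+ m) C suc k)) ≡ β k m
  recip-suc*binomial k m = begin
    recip D          ≡⟨ *-identityˡ (recip D) ⟨
    ι 1 * recip D    ≡⟨ fraction-≡ 1 (k ! ℕ.* m !) D≢0 (!≢0 (suc (k ℕ.+ m))) cross ⟩
    β k m            ∎
    where
    open ≡-Reasoning
    B = (suc k ℕ.+ m) C suc k
    D = suc k ℕ.* B
    D≢0 : D ≢ 0
    D≢0 D≡0 with ℕP.m*n≡0⇒m≡0∨n≡0 (suc k) D≡0
    ... | inj₂ B≡0 = binomial≢0 (suc k) m B≡0
    rearrange : ∀ k c x y → 1 ℕ.* (c ℕ.* ((suc k ℕ.* x) ℕ.* y)) ≡ x ℕ.* y ℕ.* (suc k ℕ.* c)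
    rearrange = ℕSolver.solve-∀
    cross : 1 ℕ.* suc (k ℕ.+ m) ! ≡ k ! ℕ.* m ! ℕ.* D
    cross = trans (cong (1 ℕ.*_) (sym (binomial-factorial (suc k) m))) (rearrange k B (k !) (m !))

  -- The case r = k + s of binomial*β below, by cross-multiplication after
  -- cancelling s!.
  binomial*β-≤ : ∀ k s → ι (suc (k ℕ.+ (k ℕ.+ s)) C suc (k ℕ.+ k)) * β k (k ℕ.+ s) ≡ ι ((k ℕ.+ s) C k) * β k k
  binomial*β-≤ k s = begin
    ι X * β k r                              ≡⟨ ι-scale X (k ! ℕ.* r !) (N !) ⟩
    ι (X ℕ.* (k ! ℕ.* r !)) * recip (N !)    ≡⟨ fraction-≡ (X ℕ.* (k ! ℕ.* r !)) (Y ℕ.* (k ! ℕ.* k !)) (!≢0 N) (!≢0 a) cross ⟩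
    ι (Y ℕ.* (k ! ℕ.* k !)) * recip (a !)    ≡⟨ ι-scale Y (k ! ℕ.* k !) (a !) ⟨
    ι Y * β k k                              ∎
    where
    open ≡-Reasoning
    r = k ℕ.+ s
    a = suc (k ℕ.+ k)
    N = suc (k ℕ.+ r)
    X = N C a
    Y = r C k
    N≡a+s : N ≡ a ℕ.+ s
    N≡a+s = cong suc (sym (ℕP.+-assoc k k s))
    X-factorial : X ℕ.* (a ! ℕ.* s !) ≡ N !
    X-factorial = subst (λ t → (t C a) ℕ.* (a ! ℕ.* s !) ≡ t !) (sym N≡a+s) (binomial-factorial a s)
    regroupˡ : ∀ x p q u v → x ℕ.* (p ℕ.* q) ℕ.* u ℕ.* v ≡ x ℕ.* (u ℕ.* v) ℕ.* (p ℕ.* q)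
    regroupˡ = ℕSolver.solve-∀
    regroupʳ : ∀ m p y v → m ℕ.* (p ℕ.* (y ℕ.* (p ℕ.* v))) ≡ y ℕ.* (p ℕ.* p) ℕ.* m ℕ.* v
    regroupʳ = ℕSolver.solve-∀
    cross : X ℕ.* (k ! ℕ.* r !) ℕ.* a ! ≡ Y ℕ.* (k ! ℕ.* k !) ℕ.* N !
    cross = ℕP.*-cancelʳ-≡ _ _ (s !) {{s ℕP.!≢0}} (begin
      X ℕ.* (k ! ℕ.* r !) ℕ.* a ! ℕ.* s !              ≡⟨ regroupˡ X (k !) (r !) (a !) (s !) ⟩
      X ℕ.* (a ! ℕ.* s !) ℕ.* (k ! ℕ.* r !)            ≡⟨ cong (ℕ._* (k ! ℕ.* r !)) X-factorial ⟩
      N ! ℕ.* (k ! ℕ.* r !)                            ≡⟨ cong (λ t → N ! ℕ.* (k ! ℕ.* t)) (binomial-factorial k s) ⟨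
      N ! ℕ.* (k ! ℕ.* (Y ℕ.* (k ! ℕ.* s !)))          ≡⟨ regroupʳ (N !) (k !) Y (s !) ⟩
      Y ℕ.* (k ! ℕ.* k !) ℕ.* N ! ℕ.* s !              ∎)

  -- C(k+r+1, 2k+1) β k r = C(r, k) β k k: both sides are k! r! / ((2k+1)! (r-k)!).
  binomial*β : ∀ k r → ι (suc (k ℕ.+ r) C suc (k ℕ.+ k)) * β k r ≡ ι (r C k) * β k k
  binomial*β k r with k ℕP.≤? r
  ... | yes k≤r with ℕP.m≤n⇒∃[o]m+o≡n k≤r
  ...   | s , refl = binomial*β-≤ k s
  binomial*β k r | no k≰r = begin
    ι (suc (k ℕ.+ r) C suc (k ℕ.+ k)) * β k r  ≡⟨ cong (λ t → ι t * β k r) (k>n⇒nCk≡0 (ℕ.s≤s (ℕP.+-monoʳ-< k r<k))) ⟩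
    0ℚ * β k r                                 ≡⟨ *-zeroˡ (β k r) ⟩
    0ℚ                                         ≡⟨ *-zeroˡ (β k k) ⟨
    0ℚ * β k k                                 ≡⟨ cong (λ t → ι t * β k k) (k>n⇒nCk≡0 r<k) ⟨
    ι (r C k) * β k k                          ∎
    where
    open ≡-Reasoning
    r<k = ℕP.≰⇒> k≰r

  binomialPrefix : ℕ → ℕ → ℚ
  binomialPrefix m l = sumTo l (λ i → ι (m C i))

  ι-pascal : ∀ m k → ι (suc m C suc k) ≡ ι (m C k) + ι (m C suc k)
  ι-pascal m k = trans (cong ι (sym (nCk+nC[k+1]≡[n+1]C[k+1] m k))) (ι-+ (m C k) (m C suc k))

  ι-pascal-prev : ∀ m k → ι (suc m C k) ≡ ι (m C k) + prev (λ j → ι (m C j)) k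
  ι-pascal-prev m zero    = sym (+-identityʳ 1ℚ)
  ι-pascal-prev m (suc k) = trans (ι-pascal m k) (+-comm (ι (m C k)) (ι (m C suc k)))

  binomialPrefix-step : ∀ m l → binomialPrefix (suc m) (suc l) ≡ binomialPrefix m (suc l) + binomialPrefix m l
  binomialPrefix-step m zero = begin
    1ℚ + ι (suc m C 1)               ≡⟨ cong (1ℚ +_) (ι-pascal m 0) ⟩
    1ℚ + (1ℚ + ι (m C 1))            ≡⟨ solve 1 (λ x → con 1ℚ :+ (con 1ℚ :+ x) := con 1ℚ :+ x :+ con 1ℚ) refl (ι (m C 1)) ⟩
    1ℚ + ι (m C 1) + 1ℚ              ∎
    where open ≡-Reasoning
  binomialPrefix-step m (suc l) = begin
    binomialPrefix (suc m) (suc l) + ι (suc m C suc (suc l))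
      ≡⟨ cong₂ _+_ (binomialPrefix-step m l) (ι-pascal m (suc l)) ⟩
    P (suc l) + P l + (ι (m C suc l) + ι (m C suc (suc l)))
      ≡⟨ solve 4 (λ a b c d → a :+ b :+ (c :+ d) := a :+ d :+ (b :+ c)) refl (P (suc l)) (P l) (ι (m C suc l)) (ι (m C suc (suc l))) ⟩
    P (suc l) + ι (m C suc (suc l)) + (P l + ι (m C suc l)) ∎
    where
    open ≡-Reasoning
    P = binomialPrefix m

  binomialPrefix-pascal : ∀ m l → binomialPrefix (suc m) l ≡ binomialPrefix m l + prev (binomialPrefix m) l
  binomialPrefix-pascal m zero    = sym (+-identityʳ 1ℚ)
  binomialPrefix-pascal m (suc l) = binomialPrefix-step m l

  binomialPrefix-full : ∀ m → binomialPrefix m m ≡ ι (2 ^ m)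
  binomialPrefix-full zero    = refl
  binomialPrefix-full (suc m) = begin
    binomialPrefix (suc m) (suc m)         ≡⟨ binomialPrefix-step m m ⟩
    P m + ι (m C suc m) + P m              ≡⟨ cong (λ t → P m + ι t + P m) (k>n⇒nCk≡0 (ℕP.n<1+n m)) ⟩
    P m + 0ℚ + P m                         ≡⟨ cong (_+ P m) (+-identityʳ (P m)) ⟩
    P m + P m                              ≡⟨ cong₂ _+_ (binomialPrefix-full m) (binomialPrefix-full m) ⟩
    ι (2 ^ m) + ι (2 ^ m)                  ≡⟨ ι-+ (2 ^ m) (2 ^ m) ⟨
    ι (2 ^ m ℕ.+ 2 ^ m)                    ≡⟨ cong (λ t → ι (2 ^ m ℕ.+ t)) (ℕP.+-identityʳ (2 ^ m)) ⟨
    ι (2 ^ suc m)                          ∎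
    where
    open ≡-Reasoning
    P = binomialPrefix m

  -- First identity: convolving a Pascal-like family with the partial row
  -- sums of row n+1 collapses to a single column,
  --   Σ_{l+r=n} (Σ_{i≤l} C(n+1, i)) γ l r  =  Σ_{k≤n} 2^k γ k 0.
  -- Passing from n to n+1, Pascal's rule for the prefixes splits the sum in
  -- two; the splitting law of γ then merges them back, leaving the new term
  -- with the full row sum 2^(n+1).
  prefix-convolution : ∀ {γ} → PascalLike γ → ∀ n →
                       antidiag n (λ l r → binomialPrefix (suc n) l * γ l r) ≡ powSum n (λ k → γ k 0)
  prefix-convolution law zero = refl
  prefix-convolution {γ} law (suc n) = begin
    antidiag (suc n) (λ l r → binomialPrefix (suc (suc n)) l * γ l r)
      ≡⟨ antidiag-ext (suc n) (λ l r _ → trans (cong (_* γ l r) (binomialPrefix-pascal (suc n) l)) (*-distribʳ-+ (γ l r) (P l) (prev P l))) ⟩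
    antidiag (suc n) (λ l r → P l * γ l r + prev P l * γ l r)
      ≡⟨ antidiag-+ (suc n) (λ l r → P l * γ l r) (λ l r → prev P l * γ l r) ⟩
    antidiag (suc n) (λ l r → P l * γ l r) + antidiag (suc n) (λ l r → prev P l * γ l r)
      ≡⟨ cong₂ _+_ (antidiag-last n (λ l r → P l * γ l r)) (antidiag-prev n (λ l r → P l) γ) ⟩
    Down + P (suc n) * γ (suc n) 0 + Left
      ≡⟨ solve 3 (λ x y z → x :+ y :+ z := x :+ z :+ y) refl Down (P (suc n) * γ (suc n) 0) Left ⟩
    Down + Left + P (suc n) * γ (suc n) 0
      ≡⟨ cong₂ _+_ merge (cong (_* γ (suc n) 0) (binomialPrefix-full (suc n))) ⟩
    antidiag n (λ l r → P l * γ l r) + ι (2 ^ suc n) * γ (suc n) 0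
      ≡⟨ cong (_+ ι (2 ^ suc n) * γ (suc n) 0) (prefix-convolution law n) ⟩
    powSum (suc n) (λ k → γ k 0) ∎
    where
    open ≡-Reasoning
    P = binomialPrefix (suc n)
    Down = antidiag n (λ l r → P l * γ l (suc r))
    Left = antidiag n (λ l r → P l * γ (suc l) r)
    merge : Down + Left ≡ antidiag n (λ l r → P l * γ l r)
    merge = trans (sym (antidiag-+ n (λ l r → P l * γ l (suc r)) (λ l r → P l * γ (suc l) r)))
                  (antidiag-ext n (λ l r _ → trans (sym (*-distribˡ-+ (P l) (γ l (suc r)) (γ (suc l) r)))
                                                   (cong (P l *_) (trans (+-comm (γ l (suc r)) (γ (suc l) r)) (sym (law l r))))))

  shift : (ℕ → ℕ → ℚ) → ℕ → ℕ → ℚ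
  shift γ l r = γ (suc l) (suc r)

  shift-pascal : ∀ {γ} → PascalLike γ → PascalLike (shift γ)
  shift-pascal law l r = law (suc l) (suc r)

  alternating : (ℕ → ℕ → ℚ) → ℕ → ℚ
  alternating γ n = antidiag n (λ k r → ι (r C k) * (sign k * γ k k))

  -- Both alternating sums and antidiagonal sums obey the recurrence
  -- X_γ(n+2) = X_γ(n+1) - X_(shift γ)(n).
  alternating-recurrence : ∀ γ n → alternating γ (suc (suc n)) ≡ alternating γ (suc n) - alternating (shift γ) n
  alternating-recurrence γ n = begin
    alternating γ (suc (suc n))
      ≡⟨ antidiag-last (suc n) (λ k r → ι (r C k) * s k) ⟩
    antidiag (suc n) (λ k r → ι (suc r C k) * s k) + 0ℚ * s (suc (suc n))
      ≡⟨ trans (cong (antidiag (suc n) (λ k r → ι (suc r C k) * s k) +_) (*-zeroˡ (s (suc (suc n))))) (+-identityʳ _) ⟩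
    antidiag (suc n) (λ k r → ι (suc r C k) * s k)
      ≡⟨ antidiag-ext (suc n) (λ k r _ → trans (cong (_* s k) (ι-pascal-prev r k)) (*-distribʳ-+ (s k) (ι (r C k)) (prev (λ j → ι (r C j)) k))) ⟩
    antidiag (suc n) (λ k r → ι (r C k) * s k + prev (λ j → ι (r C j)) k * s k)
      ≡⟨ antidiag-+ (suc n) (λ k r → ι (r C k) * s k) (λ k r → prev (λ j → ι (r C j)) k * s k) ⟩
    alternating γ (suc n) + antidiag (suc n) (λ k r → prev (λ j → ι (r C j)) k * s k)
      ≡⟨ cong (alternating γ (suc n) +_) (antidiag-prev n (λ k r → ι (r C k)) (λ k r → s k)) ⟩
    alternating γ (suc n) + antidiag n (λ k r → ι (r C k) * s (suc k))
      ≡⟨ cong (alternating γ (suc n) +_) (antidiag-ext n (λ k r _ → sign-flip (ι (r C k)) (sign k) (shift γ k k))) ⟩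
    alternating γ (suc n) + antidiag n (λ k r → - (ι (r C k) * (sign k * shift γ k k)))
      ≡⟨ cong (alternating γ (suc n) +_) (antidiag-neg n (λ k r → ι (r C k) * (sign k * shift γ k k))) ⟩
    alternating γ (suc n) - alternating (shift γ) n ∎
    where
    open ≡-Reasoning
    s : ℕ → ℚ
    s k = sign k * γ k k
    sign-flip : ∀ c σ x → c * (- σ * x) ≡ - (c * (σ * x))
    sign-flip c σ x = solve 3 (λ c σ x → c :* (:- σ :* x) := :- (c :* (σ :* x))) refl c σ x

  antidiag-recurrence : ∀ {γ} → PascalLike γ → ∀ n → antidiag (suc (suc n)) γ ≡ antidiag (suc n) γ - antidiag n (shift γ)
  antidiag-recurrence {γ} law n = +-to-- (begin
    γ 0 (suc (suc n)) + Left + antidiag n (shift γ)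
      ≡⟨ solve 3 (λ x y z → x :+ y :+ z := y :+ (x :+ z)) refl (γ 0 (suc (suc n))) Left (antidiag n (shift γ)) ⟩
    Left + antidiag (suc n) (λ l r → γ l (suc r))
      ≡⟨ antidiag-+ (suc n) (λ l r → γ (suc l) r) (λ l r → γ l (suc r)) ⟨
    antidiag (suc n) (λ l r → γ (suc l) r + γ l (suc r))
      ≡⟨ antidiag-ext (suc n) (λ l r _ → sym (law l r)) ⟩
    antidiag (suc n) γ ∎)
    where
    open ≡-Reasoning
    Left = antidiag (suc n) (λ l r → γ (suc l) r)

  -- Second identity: for a Pascal-like family, the alternating diagonal sum
  -- equals the antidiagonal sum; both sides agree for n = 0, 1 and satisfy
  -- the same recurrence, which shifts γ along the diagonal.
  alternating≡antidiag : ∀ {γ} → PascalLike γ → ∀ n → alternating γ n ≡ antidiag n γ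
  alternating≡antidiag {γ} law zero = solve 1 (λ x → con 1ℚ :* (con 1ℚ :* x) := x) refl (γ 0 0)
  alternating≡antidiag {γ} law (suc zero) = begin
    1ℚ * (1ℚ * γ 0 0) + 0ℚ * (sign 1 * γ 1 1)  ≡⟨ solve 2 (λ x y → con 1ℚ :* (con 1ℚ :* x) :+ con 0ℚ :* y := x) refl (γ 0 0) (sign 1 * γ 1 1) ⟩
    γ 0 0                                       ≡⟨ law 0 0 ⟩
    γ 1 0 + γ 0 1                               ≡⟨ +-comm (γ 1 0) (γ 0 1) ⟩
    antidiag 1 γ                                ∎
    where open ≡-Reasoning
  alternating≡antidiag {γ} law (suc (suc n)) = begin
    alternating γ (suc (suc n))                          ≡⟨ alternating-recurrence γ n ⟩
    alternating γ (suc n) - alternating (shift γ) n      ≡⟨ cong₂ _-_ (alternating≡antidiag law (suc n)) (alternating≡antidiag (shift-pascal law) n) ⟩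
    antidiag (suc n) γ - antidiag n (shift γ)            ≡⟨ antidiag-recurrence law n ⟨
    antidiag (suc (suc n)) γ                             ∎
    where open ≡-Reasoning

  powSum-column-shift : ∀ {γ} → PascalLike γ → ∀ n b →
                        ι 2 * powSum n (λ k → γ k (suc b)) + ι (2 ^ suc n) * γ (suc n) b ≡ powSum n (λ k → γ k b) + γ 0 b
  powSum-column-shift {γ} law zero b = begin
    ι 2 * (1ℚ * γ 0 (suc b)) + ι 2 * γ 1 b  ≡⟨ solve 2 (λ x y → con (ι 2) :* (con 1ℚ :* x) :+ con (ι 2) :* y := con 1ℚ :* (y :+ x) :+ (y :+ x)) refl (γ 0 (suc b)) (γ 1 b) ⟩
    1ℚ * (γ 1 b + γ 0 (suc b)) + (γ 1 b + γ 0 (suc b))  ≡⟨ cong (λ t → 1ℚ * t + t) (law 0 b) ⟨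
    1ℚ * γ 0 b + γ 0 b                       ∎
    where open ≡-Reasoning
  powSum-column-shift {γ} law (suc n) b = begin
    ι 2 * (Q + p * u) + ι (2 ℕ.* 2 ^ suc n) * v
      ≡⟨ cong (λ t → ι 2 * (Q + p * u) + t * v) (ι-* 2 (2 ^ suc n)) ⟩
    ι 2 * (Q + p * u) + ι 2 * p * v
      ≡⟨ solve 4 (λ q p u v → con (ι 2) :* (q :+ p :* u) :+ con (ι 2) :* p :* v := con (ι 2) :* q :+ p :* (v :+ u) :+ p :* (v :+ u)) refl Q p u v ⟩
    ι 2 * Q + p * (v + u) + p * (v + u)
      ≡⟨ cong (λ t → ι 2 * Q + p * t + p * t) (law (suc n) b) ⟨
    ι 2 * Q + p * w + p * w
      ≡⟨ cong (_+ p * w) (powSum-column-shift law n b) ⟩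
    powSum n (λ k → γ k b) + γ 0 b + p * w
      ≡⟨ solve 3 (λ x y z → x :+ y :+ z := x :+ z :+ y) refl (powSum n (λ k → γ k b)) (γ 0 b) (p * w) ⟩
    powSum (suc n) (λ k → γ k b) + γ 0 b ∎
    where
    open ≡-Reasoning
    Q = powSum n (λ k → γ k (suc b))
    p = ι (2 ^ suc n)
    u = γ (suc n) (suc b)
    v = γ (suc (suc n)) b
    w = γ (suc n) b

  baseSum : ℕ → ℚ
  baseSum n = powSum n (λ k → β k 0)

  2^≢0 : ∀ n → 2 ^ n ≢ 0
  2^≢0 n = ℕ.≢-nonZero⁻¹ (2 ^ n) {{ℕP.m^n≢0 2 n}}

  -- 2^(n+1) Σ_{k≤n} 2^k β k (n+1) = Σ_{k≤n} 2^k β k 0, by induction on n: the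
  -- column shift moves column n+1 to column n+2, and the two boundary terms
  -- it produces cancel by symmetry and 2 β (n+2) (n+1) = β (n+1) (n+1).
  powSum-top-column : ∀ n → ι (2 ^ suc n) * powSum n (λ k → β k (suc n)) ≡ baseSum n
  powSum-top-column zero = begin
    ι 2 * (1ℚ * β 0 1)  ≡⟨ cong (ι 2 *_) (trans (*-identityˡ (β 0 1)) (β-sym 0 1)) ⟩
    ι 2 * β 1 0         ≡⟨ β-diagonal 0 ⟩
    β 0 0               ≡⟨ *-identityˡ (β 0 0) ⟨
    1ℚ * β 0 0          ∎
    where open ≡-Reasoning
  powSum-top-column (suc n) = begin
    ι (2 ℕ.* 2 ^ suc n) * T
      ≡⟨ cong (_* T) (ι-* 2 (2 ^ suc n)) ⟩
    ι 2 * p * T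
      ≡⟨ solve 3 (λ t p x → t :* p :* x := p :* (t :* x)) refl (ι 2) p T ⟩
    p * (ι 2 * T)
      ≡⟨ cong (p *_) (+-to-- (powSum-column-shift β-pascal (suc n) (suc n))) ⟩
    p * (A + p * d + β 0 (suc n) - ι (2 ℕ.* 2 ^ suc n) * e)
      ≡⟨ cong₂ (λ x y → p * (A + p * d + x - y * e)) (β-sym 0 (suc n)) (ι-* 2 (2 ^ suc n)) ⟩
    p * (A + p * d + β (suc n) 0 - ι 2 * p * e)
      ≡⟨ solve 6 (λ p a d b t e → p :* (a :+ p :* d :+ b :- t :* p :* e) := p :* a :+ p :* b :+ p :* p :* (d :- t :* e)) refl p A d (β (suc n) 0) (ι 2) e ⟩
    p * A + p * β (suc n) 0 + p * p * (d - ι 2 * e)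
      ≡⟨ cong₂ (λ x y → x + p * β (suc n) 0 + p * p * (d - y)) (powSum-top-column n) (β-diagonal (suc n)) ⟩
    baseSum n + p * β (suc n) 0 + p * p * (d - d)
      ≡⟨ solve 4 (λ s p b d → s :+ p :* b :+ p :* p :* (d :- d) := s :+ p :* b) refl (baseSum n) p (β (suc n) 0) d ⟩
    baseSum (suc n) ∎
    where
    open ≡-Reasoning
    p = ι (2 ^ suc n)
    T = powSum (suc n) (λ k → β k (suc (suc n)))
    A = powSum n (λ k → β k (suc n))
    d = β (suc n) (suc n)
    e = β (suc (suc n)) (suc n)

  top-column-value : ∀ n → ι 2 * powSum n (λ k → β k (suc n)) ≡ baseSum n * recip (2 ^ n)
  top-column-value n = isolate (2^≢0 n) (begin
    ι (2 ^ n) * (ι 2 * A)     ≡⟨ solve 3 (λ q t a → q :* (t :* a) := t :* q :* a) refl (ι (2 ^ n)) (ι 2) A ⟩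
    ι 2 * ι (2 ^ n) * A       ≡⟨ cong (_* A) (ι-* 2 (2 ^ n)) ⟨
    ι (2 ^ suc n) * A         ≡⟨ powSum-top-column n ⟩
    baseSum n                 ∎)
    where
    open ≡-Reasoning
    A = powSum n (λ k → β k (suc n))

  -- Doubling an antidiagonal sum: each term of diagonal n splits into a term
  -- of diagonal n+1 to the right and one below it; only the two corner terms
  -- of diagonal n+1 are missed.
  antidiag-double : ∀ {γ} → PascalLike γ → ∀ n → antidiag n γ + γ 0 (suc n) + γ (suc n) 0 ≡ ι 2 * antidiag (suc n) γ
  antidiag-double {γ} law n = begin
    antidiag n γ + γ 0 (suc n) + γ (suc n) 0
      ≡⟨ cong (λ t → t + γ 0 (suc n) + γ (suc n) 0) split ⟩
    Left + Down + γ 0 (suc n) + γ (suc n) 0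
      ≡⟨ solve 4 (λ l d x y → l :+ d :+ x :+ y := (x :+ l) :+ (d :+ y)) refl Left Down (γ 0 (suc n)) (γ (suc n) 0) ⟩
    antidiag (suc n) γ + (Down + γ (suc n) 0)
      ≡⟨ cong (antidiag (suc n) γ +_) (antidiag-last n γ) ⟨
    antidiag (suc n) γ + antidiag (suc n) γ
      ≡⟨ solve 1 (λ x → x :+ x := con (ι 2) :* x) refl (antidiag (suc n) γ) ⟩
    ι 2 * antidiag (suc n) γ ∎
    where
    open ≡-Reasoning
    Left = antidiag n (λ l r → γ (suc l) r)
    Down = antidiag n (λ l r → γ l (suc r))
    split : antidiag n γ ≡ Left + Down
    split = trans (antidiag-ext n (λ l r _ → law l r)) (antidiag-+ n (λ l r → γ (suc l) r) (λ l r → γ l (suc r)))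

  antidiag-β : ∀ n → ι (2 ^ n) * antidiag n β ≡ baseSum n
  antidiag-β zero    = refl
  antidiag-β (suc n) = begin
    ι (2 ℕ.* 2 ^ n) * antidiag (suc n) β
      ≡⟨ cong (_* antidiag (suc n) β) (ι-* 2 (2 ^ n)) ⟩
    ι 2 * q * antidiag (suc n) β
      ≡⟨ solve 3 (λ t q x → t :* q :* x := q :* (t :* x)) refl (ι 2) q (antidiag (suc n) β) ⟩
    q * (ι 2 * antidiag (suc n) β)
      ≡⟨ cong (q *_) (antidiag-double β-pascal n) ⟨
    q * (antidiag n β + β 0 (suc n) + β (suc n) 0)
      ≡⟨ cong (λ x → q * (antidiag n β + x + β (suc n) 0)) (β-sym 0 (suc n)) ⟩
    q * (antidiag n β + β (suc n) 0 + β (suc n) 0)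
      ≡⟨ solve 3 (λ q r b → q :* (r :+ b :+ b) := q :* r :+ con (ι 2) :* q :* b) refl q (antidiag n β) (β (suc n) 0) ⟩
    q * antidiag n β + ι 2 * q * β (suc n) 0
      ≡⟨ cong₂ _+_ (antidiag-β n) (cong (_* β (suc n) 0) (sym (ι-* 2 (2 ^ n)))) ⟩
    baseSum (suc n) ∎
    where
    open ≡-Reasoning
    q = ι (2 ^ n)

  antidiag-β-value : ∀ n → antidiag n β ≡ baseSum n * recip (2 ^ n)
  antidiag-β-value n = isolate (2^≢0 n) (antidiag-β n)

  value : ℕ → ℚ
  value n = ι (suc n) * (baseSum n * recip (2 ^ n))

  n+1≡1+n : ∀ n → n ℕ.+ 1 ≡ suc n
  n+1≡1+n n = ℕP.+-comm n 1

  row-prefix : ∀ n j d → sumTo j (λ i → ℕtoℚ ((n ℕ.+ 1) C i) ÷ℕ d) ≡ binomialPrefix (suc n) j * recip d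
  row-prefix n j d = begin
    sumTo j (λ i → ι ((n ℕ.+ 1) C i) ÷ℕ d)       ≡⟨ sumTo-ext j (λ i → ÷ℕ-recip (ι ((n ℕ.+ 1) C i)) d) ⟩
    sumTo j (λ i → ι ((n ℕ.+ 1) C i) * recip d)  ≡⟨ sumTo-*ʳ j (recip d) (λ i → ι ((n ℕ.+ 1) C i)) ⟩
    binomialPrefix (n ℕ.+ 1) j * recip d         ≡⟨ cong (λ m → binomialPrefix m j * recip d) (n+1≡1+n n) ⟩
    binomialPrefix (suc n) j * recip d           ∎
    where open ≡-Reasoning

  -- First expression: with l + r = n,  1 / C(2n+1, l) = 2 (n+1) β l (r+n+1).
  first-eval : ∀ n → sumTo n (λ j → sumTo j (λ i → ℕtoℚ ((n ℕ.+ 1) C i) ÷ℕ ((2 ℕ.* n ℕ.+ 1) C j)))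
                     ≡ value n
  first-eval n = begin
    sumTo n (λ j → sumTo j (λ i → ℕtoℚ ((n ℕ.+ 1) C i) ÷ℕ ((2 ℕ.* n ℕ.+ 1) C j)))
      ≡⟨ sumTo-ext n (λ j → row-prefix n j ((2 ℕ.* n ℕ.+ 1) C j)) ⟩
    sumTo n (λ j → P j * recip ((2 ℕ.* n ℕ.+ 1) C j))
      ≡⟨ sumTo-as-antidiag n (λ j → P j * recip ((2 ℕ.* n ℕ.+ 1) C j)) ⟩
    antidiag n (λ l r → P l * recip ((2 ℕ.* n ℕ.+ 1) C l))
      ≡⟨ antidiag-ext n (λ l r l+r≡n → trans (cong (P l *_) (recip-binomial-2n+1 l r l+r≡n))
                                              (solve 4 (λ p a t b → p :* (a :* t :* b) := a :* t :* (p :* b)) refl (P l) (ι (suc n)) (ι 2) (β l (r ℕ.+ suc n)))) ⟩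
    antidiag n (λ l r → ι (suc n) * ι 2 * (P l * β l (r ℕ.+ suc n)))
      ≡⟨ antidiag-*ˡ n (ι (suc n) * ι 2) (λ l r → P l * β l (r ℕ.+ suc n)) ⟩
    ι (suc n) * ι 2 * antidiag n (λ l r → P l * β l (r ℕ.+ suc n))
      ≡⟨ cong (ι (suc n) * ι 2 *_) (prefix-convolution (λ l r → β-pascal l (r ℕ.+ suc n)) n) ⟩
    ι (suc n) * ι 2 * powSum n (λ k → β k (suc n))
      ≡⟨ *-assoc (ι (suc n)) (ι 2) _ ⟩
    ι (suc n) * (ι 2 * powSum n (λ k → β k (suc n)))
      ≡⟨ cong (ι (suc n) *_) (top-column-value n) ⟩
    value n ∎
    where
    open ≡-Reasoning
    P = binomialPrefix (suc n)
    shape : ∀ l r → 2 ℕ.* (l ℕ.+ r) ℕ.+ 1 ≡ l ℕ.+ (r ℕ.+ suc (l ℕ.+ r))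
    shape = ℕSolver.solve-∀
    factor : ∀ l r → suc (l ℕ.+ (r ℕ.+ suc (l ℕ.+ r))) ≡ suc (l ℕ.+ r) ℕ.* 2
    factor = ℕSolver.solve-∀
    recip-binomial-2n+1 : ∀ l r → l ℕ.+ r ≡ n → recip ((2 ℕ.* n ℕ.+ 1) C l) ≡ ι (suc n) * ι 2 * β l (r ℕ.+ suc n)
    recip-binomial-2n+1 l r refl = begin
      recip ((2 ℕ.* (l ℕ.+ r) ℕ.+ 1) C l)               ≡⟨ cong (λ t → recip (t C l)) (shape l r) ⟩
      recip ((l ℕ.+ (r ℕ.+ suc (l ℕ.+ r))) C l)         ≡⟨ recip-binomial l (r ℕ.+ suc (l ℕ.+ r)) ⟩
      ι (suc (l ℕ.+ (r ℕ.+ suc (l ℕ.+ r)))) * β l _     ≡⟨ cong (λ t → ι t * β l (r ℕ.+ suc (l ℕ.+ r))) (factor l r) ⟩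
      ι (suc (l ℕ.+ r) ℕ.* 2) * β l _                   ≡⟨ cong (_* β l (r ℕ.+ suc (l ℕ.+ r))) (ι-* (suc (l ℕ.+ r)) 2) ⟩
      ι (suc (l ℕ.+ r)) * ι 2 * β l (r ℕ.+ suc (l ℕ.+ r)) ∎

  -- A summand of the second expression vanishes once 2k+1 > n+1.
  beyond-half : ∀ n i → n / 2 ℕ.< i → n ℕ.< 2 ℕ.* i
  beyond-half n i n/2<i = begin-strict
    n                    ≡⟨ m≡m%n+[m/n]*n n 2 ⟩
    n % 2 ℕ.+ n / 2 ℕ.* 2  <⟨ ℕP.+-monoˡ-< (n / 2 ℕ.* 2) (m%n<n n 2) ⟩
    suc (n / 2) ℕ.* 2     ≤⟨ ℕP.*-monoˡ-≤ 2 n/2<i ⟩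
    i ℕ.* 2              ≡⟨ ℕP.*-comm i 2 ⟩
    2 ℕ.* i              ∎
    where open ℕP.≤-Reasoning

  -- Second expression: with k + r = n,
  --   C(n+1, 2k+1) / C(n, k) = (n+1) C(r, k) β k k.
  second-eval : ∀ n → sumTo (n / 2) (λ k → sign k * (ℕtoℚ ((n ℕ.+ 1) C (2 ℕ.* k ℕ.+ 1)) ÷ℕ (n C k))) ≡ value n
  second-eval n = begin
    sumTo (n / 2) g                        ≡⟨ sumTo-vanishing-tail (n / 2) (n ℕ.∸ n / 2) g vanishes ⟨
    sumTo (n ℕ.∸ n / 2 ℕ.+ n / 2) g        ≡⟨ cong (λ t → sumTo t g) (ℕP.m∸n+n≡m (m/n≤m n 2)) ⟩
    sumTo n g                              ≡⟨ sumTo-as-antidiag n g ⟩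
    antidiag n (λ k r → g k)               ≡⟨ antidiag-ext n summand ⟩
    antidiag n (λ k r → ι (suc n) * (ι (r C k) * (sign k * β k k)))  ≡⟨ antidiag-*ˡ n (ι (suc n)) _ ⟩
    ι (suc n) * alternating β n            ≡⟨ cong (ι (suc n) *_) (alternating≡antidiag β-pascal n) ⟩
    ι (suc n) * antidiag n β               ≡⟨ cong (ι (suc n) *_) (antidiag-β-value n) ⟩
    value n                                ∎
    where
    open ≡-Reasoning
    g : ℕ → ℚ
    g k = sign k * (ℕtoℚ ((n ℕ.+ 1) C (2 ℕ.* k ℕ.+ 1)) ÷ℕ (n C k))
    vanishes : ∀ i → n / 2 ℕ.< i → g i ≡ 0ℚ
    vanishes i n/2<i = begin
      g i                                ≡⟨ cong (λ t → sign i * (ι t ÷ℕ (n C i))) (k>n⇒nCk≡0 (ℕP.+-monoˡ-< 1 (beyond-half n i n/2<i))) ⟩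
      sign i * (0ℚ ÷ℕ (n C i))           ≡⟨ cong (sign i *_) (÷ℕ-recip 0ℚ (n C i)) ⟩
      sign i * (0ℚ * recip (n C i))      ≡⟨ solve 2 (λ s x → s :* (con 0ℚ :* x) := con 0ℚ) refl (sign i) (recip (n C i)) ⟩
      0ℚ                                 ∎
    odd : ∀ k → 2 ℕ.* k ℕ.+ 1 ≡ suc (k ℕ.+ k)
    odd = ℕSolver.solve-∀
    summand : ∀ k r → k ℕ.+ r ≡ n → g k ≡ ι (suc n) * (ι (r C k) * (sign k * β k k))
    summand k r refl = begin
      sign k * (ι X ÷ℕ ((k ℕ.+ r) C k))                      ≡⟨ cong (sign k *_) (÷ℕ-recip (ι X) ((k ℕ.+ r) C k)) ⟩
      sign k * (ι X * recip ((k ℕ.+ r) C k))                 ≡⟨ cong₂ (λ t u → sign k * (ι t * u)) (cong₂ _C_ (n+1≡1+n (k ℕ.+ r)) (odd k)) (recip-binomial k r) ⟩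
      sign k * (ι Y * (ι (suc (k ℕ.+ r)) * β k r))           ≡⟨ solve 4 (λ s y m b → s :* (y :* (m :* b)) := m :* (s :* (y :* b))) refl (sign k) (ι Y) (ι (suc (k ℕ.+ r))) (β k r) ⟩
      ι (suc (k ℕ.+ r)) * (sign k * (ι Y * β k r))           ≡⟨ cong (λ t → ι (suc (k ℕ.+ r)) * (sign k * t)) (binomial*β k r) ⟩
      ι (suc (k ℕ.+ r)) * (sign k * (ι (r C k) * β k k))     ≡⟨ cong (ι (suc (k ℕ.+ r)) *_) (solve 3 (λ s c b → s :* (c :* b) := c :* (s :* b)) refl (sign k) (ι (r C k)) (β k k)) ⟩
      ι (suc (k ℕ.+ r)) * (ι (r C k) * (sign k * β k k))     ∎
      where
      X = (k ℕ.+ r ℕ.+ 1) C (2 ℕ.* k ℕ.+ 1)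
      Y = suc (k ℕ.+ r) C suc (k ℕ.+ k)

  -- Third expression: 2^(k+1) / ((k+1) C(n+k+2, k+1)) = 2 · 2^k β k (n+1).
  third-eval : ∀ n → ℕtoℚ (n ℕ.+ 1) * sum1To (n ℕ.+ 1) (λ k → ℕtoℚ (2 ^ k) ÷ℕ (k ℕ.* ((n ℕ.+ 1 ℕ.+ k) C k)))
                     ≡ value n
  third-eval n rewrite n+1≡1+n n = cong (ι (suc n) *_) (begin
    sum1To (suc n) f                                      ≡⟨ sum1To-suc n f ⟩
    sumTo n (λ k → f (suc k))                             ≡⟨ sumTo-ext n summand ⟩
    sumTo n (λ k → ι 2 * (ι (2 ^ k) * β k (suc n)))       ≡⟨ sumTo-*ˡ n (ι 2) (λ k → ι (2 ^ k) * β k (suc n)) ⟩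
    ι 2 * powSum n (λ k → β k (suc n))                    ≡⟨ top-column-value n ⟩
    baseSum n * recip (2 ^ n)                             ∎)
    where
    open ≡-Reasoning
    f : ℕ → ℚ
    f k = ℕtoℚ (2 ^ k) ÷ℕ (k ℕ.* ((suc n ℕ.+ k) C k))
    summand : ∀ k → f (suc k) ≡ ι 2 * (ι (2 ^ k) * β k (suc n))
    summand k = begin
      f (suc k)                                                 ≡⟨ ÷ℕ-recip (ι (2 ^ suc k)) (suc k ℕ.* ((suc n ℕ.+ suc k) C suc k)) ⟩
      ι (2 ^ suc k) * recip (suc k ℕ.* ((suc n ℕ.+ suc k) C suc k))  ≡⟨ cong (λ t → ι (2 ^ suc k) * recip (suc k ℕ.* (t C suc k))) (ℕP.+-comm (suc n) (suc k)) ⟩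
      ι (2 ^ suc k) * recip (suc k ℕ.* ((suc k ℕ.+ suc n) C suc k))  ≡⟨ cong₂ _*_ (ι-* 2 (2 ^ k)) (recip-suc*binomial k (suc n)) ⟩
      ι 2 * ι (2 ^ k) * β k (suc n)                             ≡⟨ *-assoc (ι 2) (ι (2 ^ k)) (β k (suc n)) ⟩
      ι 2 * (ι (2 ^ k) * β k (suc n))                           ∎

  -- Fourth expression: 2^(k+1) / (k+1) = 2 · 2^k β k 0.
  fourth-eval : ∀ n → (ℕtoℚ (n ℕ.+ 1) ÷ℕ (2 ^ (n ℕ.+ 1))) * sum1To (n ℕ.+ 1) (λ k → ℕtoℚ (2 ^ k) ÷ℕ k)
                      ≡ value n
  fourth-eval n rewrite n+1≡1+n n = begin
    (ι (suc n) ÷ℕ (2 ^ suc n)) * sum1To (suc n) f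
      ≡⟨ cong₂ _*_ (÷ℕ-recip (ι (suc n)) (2 ^ suc n)) (sum1To-suc n f) ⟩
    ι (suc n) * recip (2 ℕ.* 2 ^ n) * sumTo n (λ k → f (suc k))
      ≡⟨ cong₂ (λ u v → ι (suc n) * u * v) (recip-* 2 (2 ^ n)) (trans (sumTo-ext n summand) (sumTo-*ˡ n (ι 2) (λ k → ι (2 ^ k) * β k 0))) ⟩
    ι (suc n) * (recip 2 * recip (2 ^ n)) * (ι 2 * baseSum n)
      ≡⟨ solve 5 (λ a h q t s → a :* (h :* q) :* (t :* s) := a :* (s :* q) :* (t :* h)) refl (ι (suc n)) (recip 2) (recip (2 ^ n)) (ι 2) (baseSum n) ⟩
    ι (suc n) * (baseSum n * recip (2 ^ n)) * (ι 2 * recip 2)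
      ≡⟨ trans (cong (ι (suc n) * (baseSum n * recip (2 ^ n)) *_) (ι*recip 2 (λ ()))) (*-identityʳ _) ⟩
    ι (suc n) * (baseSum n * recip (2 ^ n)) ∎
    where
    open ≡-Reasoning
    f : ℕ → ℚ
    f k = ℕtoℚ (2 ^ k) ÷ℕ k
    summand : ∀ k → f (suc k) ≡ ι 2 * (ι (2 ^ k) * β k 0)
    summand k = begin
      f (suc k)                          ≡⟨ ÷ℕ-recip (ι (2 ^ suc k)) (suc k) ⟩
      ι (2 ^ suc k) * recip (suc k)      ≡⟨ cong₂ _*_ (sym (ι-* 2 (2 ^ k))) (β-zeroʳ k) ⟨
      ι 2 * ι (2 ^ k) * β k 0            ≡⟨ *-assoc (ι 2) (ι (2 ^ k)) (β k 0) ⟩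
      ι 2 * (ι (2 ^ k) * β k 0)          ∎

  -- Fifth expression: with l + r = n,  1 / C(n, l) = (n+1) β l r.
  fifth-eval : ∀ n → sumTo n (λ j → sumTo j (λ i → ℕtoℚ ((n ℕ.+ 1) C i) ÷ℕ (n C j))) ÷ℕ (2 ^ n)
                     ≡ value n
  fifth-eval n = begin
    sumTo n (λ j → sumTo j (λ i → ℕtoℚ ((n ℕ.+ 1) C i) ÷ℕ (n C j))) ÷ℕ (2 ^ n)
      ≡⟨ ÷ℕ-recip _ (2 ^ n) ⟩
    sumTo n (λ j → sumTo j (λ i → ℕtoℚ ((n ℕ.+ 1) C i) ÷ℕ (n C j))) * recip (2 ^ n)
      ≡⟨ cong (_* recip (2 ^ n)) (sumTo-ext n (λ j → row-prefix n j (n C j))) ⟩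
    sumTo n (λ j → P j * recip (n C j)) * recip (2 ^ n)
      ≡⟨ cong (_* recip (2 ^ n)) (sumTo-as-antidiag n (λ j → P j * recip (n C j))) ⟩
    antidiag n (λ l r → P l * recip (n C l)) * recip (2 ^ n)
      ≡⟨ cong (_* recip (2 ^ n)) (antidiag-ext n summand) ⟩
    antidiag n (λ l r → ι (suc n) * (P l * β l r)) * recip (2 ^ n)
      ≡⟨ cong (_* recip (2 ^ n)) (antidiag-*ˡ n (ι (suc n)) (λ l r → P l * β l r)) ⟩
    ι (suc n) * antidiag n (λ l r → P l * β l r) * recip (2 ^ n)
      ≡⟨ cong (λ t → ι (suc n) * t * recip (2 ^ n)) (prefix-convolution β-pascal n) ⟩
    ι (suc n) * baseSum n * recip (2 ^ n)
      ≡⟨ *-assoc (ι (suc n)) (baseSum n) (recip (2 ^ n)) ⟩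
    ι (suc n) * (baseSum n * recip (2 ^ n)) ∎
    where
    open ≡-Reasoning
    P = binomialPrefix (suc n)
    summand : ∀ l r → l ℕ.+ r ≡ n → P l * recip (n C l) ≡ ι (suc n) * (P l * β l r)
    summand l r refl = trans (cong (P l *_) (recip-binomial l r))
                             (solve 3 (λ p m b → p :* (m :* b) := m :* (p :* b)) refl (P l) (ι (suc (l ℕ.+ r))) (β l r))


open import Defs
open import Data.Nat using (ℕ; _+_; _*_; _^_; _/_)
open import Data.Nat.Combinatorics using (_C_)
open import Data.Rational using (ℚ) renaming (_*_ to _*ℚ_)
open import Data.Product using (_×_; _,_)
open import Relation.Binary.PropositionalEquality using (_≡_; sym; trans)
open BetaSums using (first-eval; second-eval; third-eval; fourth-eval; fifth-eval)

proposition13 : (n : ℕ) →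
  (sumTo n (λ j → sumTo j (λ i → ℕtoℚ ((n + 1) C i) ÷ℕ ((2 * n + 1) C j)))
    ≡ sumTo (n / 2) (λ k → sign k *ℚ (ℕtoℚ ((n + 1) C (2 * k + 1)) ÷ℕ (n C k))))
  × (sumTo (n / 2) (λ k → sign k *ℚ (ℕtoℚ ((n + 1) C (2 * k + 1)) ÷ℕ (n C k)))
    ≡ ℕtoℚ (n + 1) *ℚ sum1To (n + 1) (λ k → ℕtoℚ (2 ^ k) ÷ℕ (k * ((n + 1 + k) C k))))
  × (ℕtoℚ (n + 1) *ℚ sum1To (n + 1) (λ k → ℕtoℚ (2 ^ k) ÷ℕ (k * ((n + 1 + k) C k)))
    ≡ (ℕtoℚ (n + 1) ÷ℕ (2 ^ (n + 1))) *ℚ sum1To (n + 1) (λ k → ℕtoℚ (2 ^ k) ÷ℕ k))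
  × ((ℕtoℚ (n + 1) ÷ℕ (2 ^ (n + 1))) *ℚ sum1To (n + 1) (λ k → ℕtoℚ (2 ^ k) ÷ℕ k)
    ≡ sumTo n (λ j → sumTo j (λ i → ℕtoℚ ((n + 1) C i) ÷ℕ (n C j))) ÷ℕ (2 ^ n))
proposition13 n =
  trans (first-eval n) (sym (second-eval n)) , trans (second-eval n) (sym (third-eval n)) ,
  trans (third-eval n) (sym (fourth-eval n)) , trans (fourth-eval n) (sym (fifth-eval n))
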